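{- $r_3(A^{Ko})\equiv A^{G}$ and $r_4(A^{Ko})\equiv A^{E}$, where $A^{E}:\equiv\neg A_{E}$.
   Context: Logic: CL and IL first-order logic with primitives $\bot,\top,\wedge,\vee,\to,\forall,\exists$; $\neg A$ abbreviates $A\to\bot$; $\equiv$ is syntactic identity. Kolmogorov translation $A^{Ko}$: $P^{Ko}:\equiv\neg\neg P$ ($P$ atomic), $(A\square B)^{Ko}:\equiv\neg\neg(A^{Ko}\square B^{Ko})$ for $\square\in\{\wedge,\vee,\to\}$, $(QxA)^{Ko}:\equiv\neg\neg QxA^{Ko}$ for $Q\in\{\forall,\exists\}$. Translation $A^{G}$: $P^{G}:\equiv\neg\neg P$, $(A\wedge B)^{G}:\equiv A^{G}\wedge B^{G}$, $(A\vee B)^{G}:\equiv\neg A^{G}\to B^{G}$, $(A\to B)^{G}:\equiv A^{G}\to B^{G}$, $(\forall xA)^{G}:\equiv\forall xA^{G}$, $(\exists xA)^{G}:\equiv\neg\neg\exists xA^{G}$. Translation $A_{E}$: $P_{E}:\equiv\neg P$, $(A\wedge B)_{E}:\equiv\neg A_{E}\to B_{E}$, $(A\vee B)_{E}:\equiv A_{E}\wedge B_{E}$, $(A\to B)_{E}:\equiv\neg A_{E}\wedge B_{E}$, $(\forall xA)_{E}:\equiv\neg\forall x\neg A_{E}$, $(\exists xA)_{E}:\equiv\forall xA_{E}$; and $A^{E}:\equiv\neg A_{E}$. Simplifications: $r_3$ consists of $\neg\neg(\neg\neg A\wedge\neg\neg B)\Rightarrow\neg\neg A\wedge\neg\neg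 B$, $\neg\neg(\neg\neg A\vee\neg\neg B)\Rightarrow\neg\neg\neg A\to\neg\neg B$, $\neg\neg(\neg\neg A\to\neg\neg B)\Rightarrow\neg\neg A\to\neg\neg B$, $\neg\neg\forall x\neg\neg A\Rightarrow\forall x\neg\neg A$; $r_4$ consists of $\neg(\neg\neg A\wedge\neg\neg B)\Rightarrow\neg\neg A\to\neg B$, $\neg(\neg\neg A\vee\neg\neg B)\Rightarrow\neg A\wedge\neg B$, $\neg(\neg\neg A\to\neg\neg B)\Rightarrow\neg\neg A\wedge\neg B$, $\neg\exists x\neg\neg A\Rightarrow\forall x\neg A$. A simplification path from $A^{Ko}$ is obtained by successively replacing a subformula of the shape of a left-hand side by the corresponding right-hand side until no further replacement is possible. For $r$ a subset of a maximal simplification, $r(A^{Ko})$ denotes the formula in the last node of a simplification path from $A^{Ko}$ of longest length (well defined since all longest paths end in the same formula). -}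

module Defs where

open import Data.Nat using (ℕ; zero; suc; _≤_)
open import Data.Product using (Σ; _×_)
open import Relation.Binary.PropositionalEquality using (_≡_)
open import Relation.Nullary using (¬_)

-- Variables are named by natural numbers; atomic formulas P (predicate
-- symbols applied to terms) are drawn from an arbitrary type At.
Var : Set
Var = ℕ

infixr 6 _∧'_
infixr 5 _∨'_
infixr 4 _⇒_

data Formula (At : Set) : Set where
  atom  : At → Formula At
  ⊥'    : Formula At
  ⊤'    : Formula At
  _∧'_  : Formula At → Formula At → Formula At
  _∨'_  : Formula At → Formula At → Formula At
  _⇒_   : Formula At → Formula At → Formula At
  ∀'    : Var → Formula At → Formula At
  ∃'    : Var → Formula At → Formula At

module _ {At : Set} where

  ~ : Formula At → Formula At
  ~ A = A ⇒ ⊥'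

  ~~ : Formula At → Formula At
  ~~ A = ~ (~ A)

  -- Kolmogorov translation. The primitives ⊥ and ⊤ are atomic formulas
  -- (they are treated like any atomic P).
  Ko : Formula At → Formula At
  Ko (atom P)  = ~~ (atom P)
  Ko ⊥'        = ~~ ⊥'
  Ko ⊤'        = ~~ ⊤'
  Ko (A ∧' B)  = ~~ (Ko A ∧' Ko B)
  Ko (A ∨' B)  = ~~ (Ko A ∨' Ko B)
  Ko (A ⇒ B)   = ~~ (Ko A ⇒ Ko B)
  Ko (∀' x A)  = ~~ (∀' x (Ko A))
  Ko (∃' x A)  = ~~ (∃' x (Ko A))

  G : Formula At → Formula At
  G (atom P)  = ~~ (atom P)
  G ⊥'        = ~~ ⊥'
  G ⊤'        = ~~ ⊤'
  G (A ∧' B)  = G A ∧' G B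
  G (A ∨' B)  = ~ (G A) ⇒ G B
  G (A ⇒ B)   = G A ⇒ G B
  G (∀' x A)  = ∀' x (G A)
  G (∃' x A)  = ~~ (∃' x (G A))

  E↓ : Formula At → Formula At
  E↓ (atom P)  = ~ (atom P)
  E↓ ⊥'        = ~ ⊥'
  E↓ ⊤'        = ~ ⊤'
  E↓ (A ∧' B)  = ~ (E↓ A) ⇒ E↓ B
  E↓ (A ∨' B)  = E↓ A ∧' E↓ B
  E↓ (A ⇒ B)   = ~ (E↓ A) ∧' E↓ B
  E↓ (∀' x A)  = ~ (∀' x (~ (E↓ A)))
  E↓ (∃' x A)  = ∀' x (E↓ A)

  E↑ : Formula At → Formula At
  E↑ A = ~ (E↓ A)

  -- Simplification rules r₃ (root instances: lhs ⇒ rhs)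
  data r₃ : Formula At → Formula At → Set where
    r₃∧ : ∀ A B → r₃ (~~ (~~ A ∧' ~~ B)) (~~ A ∧' ~~ B)
    r₃∨ : ∀ A B → r₃ (~~ (~~ A ∨' ~~ B)) (~ (~~ A) ⇒ ~~ B)
    r₃⇒ : ∀ A B → r₃ (~~ (~~ A ⇒ ~~ B)) (~~ A ⇒ ~~ B)
    r₃∀ : ∀ x A → r₃ (~~ (∀' x (~~ A))) (∀' x (~~ A))

  data r₄ : Formula At → Formula At → Set where
    r₄∧ : ∀ A B → r₄ (~ (~~ A ∧' ~~ B)) (~~ A ⇒ ~ B)
    r₄∨ : ∀ A B → r₄ (~ (~~ A ∨' ~~ B)) (~ A ∧' ~ B)
    r₄⇒ : ∀ A B → r₄ (~ (~~ A ⇒ ~~ B)) (~~ A ∧' ~ B)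
    r₄∃ : ∀ x A → r₄ (~ (∃' x (~~ A))) (∀' x (~ A))

  data Step (R : Formula At → Formula At → Set) : Formula At → Formula At → Set where
    root : ∀ {A B} → R A B → Step R A B
    ∧ˡ : ∀ {A A' B} → Step R A A' → Step R (A ∧' B) (A' ∧' B)
    ∧ʳ : ∀ {A B B'} → Step R B B' → Step R (A ∧' B) (A ∧' B')
    ∨ˡ : ∀ {A A' B} → Step R A A' → Step R (A ∨' B) (A' ∨' B)
    ∨ʳ : ∀ {A B B'} → Step R B B' → Step R (A ∨' B) (A ∨' B')
    ⇒ˡ : ∀ {A A' B} → Step R A A' → Step R (A ⇒ B) (A' ⇒ B)
    ⇒ʳ : ∀ {A B B'} → Step R B B' → Step R (A ⇒ B) (A ⇒ B')
    ∀c : ∀ {x A A'} → Step R A A' → Step R (∀' x A) (∀' x A')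
    ∃c : ∀ {x A A'} → Step R A A' → Step R (∃' x A) (∃' x A')

  data Steps (R : Formula At → Formula At → Set) : ℕ → Formula At → Formula At → Set where
    done : ∀ {A} → Steps R zero A A
    _∷_  : ∀ {n A B C} → Step R A B → Steps R n B C → Steps R (suc n) A C

  Normal : (R : Formula At → Formula At → Set) → Formula At → Set
  Normal R B = ∀ C → ¬ Step R B C

  SimpPath : (R : Formula At → Formula At → Set) → ℕ → Formula At → Formula At → Set
  SimpPath R n A B = Steps R n A B × Normal R B

  -- "R(A) ≡ B": there is a longest simplification path from A (length n),
  -- it ends in B, and every longest simplification path from A ends in B.
  ResultIs : (R : Formula At → Formula At → Set) → Formula At → Formula At → Set
  ResultIs R A B =
    Σ ℕ λ n →
      SimpPath R n A B
      × (∀ m C → SimpPath R m A C → m ≤ n)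
      × (∀ C → SimpPath R n A C → C ≡ B)

module Submission where

-- Every formula reachable from A^Ko is described by a marking of A: for each
-- connective of A that a rule can remove, a flag saying whether it has already
-- been simplified.  The formula of a marking is computed compositionally; no
-- flag set gives A^Ko, all flags set give A^G (for r₃) resp. A^E (for r₄).  The
-- rank of a marking is its number of unset flags.  The key lemma (flips₃,
-- flips₄) says that a single simplification step always sets exactly one flag,
-- so it lowers the rank by one.  Setting the flags from the root downwards is a
-- path of length rank(no flag set) (simplify₃, simplify₄); other orders may get
-- stuck earlier, since simplifying a subformula first can destroy the pattern
-- of the outer rule.  The abstract rank argument (module RankArgument) turns
-- these facts into the claim: the longest paths have exactly that length and
-- all end in the rank-0 formula, i.e. in A^G resp. A^E.

open import Defs
open import Data.Bool using (Bool; true; false)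
open import Data.Empty using (⊥-elim)
open import Data.Nat using (ℕ; suc; _+_; _≤_)
open import Data.Nat.Properties using (+-suc; +-identityʳ; +-cancelˡ-≡; m≤m+n; m+n≡0⇒m≡0; m+n≡0⇒n≡0)
open import Data.Product using (Σ; _×_; _,_; proj₁; proj₂)
open import Relation.Binary.PropositionalEquality using (_≡_; refl; sym; trans; cong; cong₂; subst; subst₂)
open import Relation.Nullary using (¬_)

module _ {At : Set} where

  _++ˢ_ : ∀ {R : Formula At → Formula At → Set} {m n A B C} →
          Steps R m A B → Steps R n B C → Steps R (m + n) A C
  done ++ˢ q = q
  (s ∷ p) ++ˢ q = s ∷ (p ++ˢ q)

  inContext : ∀ {R : Formula At → Formula At → Set} (ctx : Formula At → Formula At) →
              (∀ {X Y} → Step R X Y → Step R (ctx X) (ctx Y)) →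
              ∀ {n A B} → Steps R n A B → Steps R n (ctx A) (ctx B)
  inContext ctx lift done = done
  inContext ctx lift (s ∷ p) = lift s ∷ inContext ctx lift p

  module RankArgument (R : Formula At → Formula At → Set)
    {State : Set} (form : State → Formula At) (rank : State → ℕ)
    (Flip : State → State → Set)
    (flip-rank : ∀ {s s'} → Flip s s' → rank s ≡ suc (rank s'))
    (flips : ∀ s {C} → Step R (form s) C → Σ State λ s' → Flip s s' × C ≡ form s')
    where

    reachable : ∀ {m C} s → Steps R m (form s) C → Σ State λ s' → C ≡ form s' × rank s ≡ m + rank s'
    reachable s done = s , refl , refl
    reachable s (st ∷ p) with flips s st
    ... | s₁ , φ , refl with reachable s₁ p
    ... | s' , e , r = s' , e , trans (flip-rank φ) (cong suc r)

    rank-zero-normal : ∀ s → rank s ≡ 0 → Normal R (form s)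
    rank-zero-normal s r C st with flips s st
    ... | _ , φ , _ with trans (sym r) (flip-rank φ)
    ... | ()

    result : (start goal : State) → rank goal ≡ 0 →
             Steps R (rank start) (form start) (form goal) →
             (∀ s → rank s ≡ 0 → form s ≡ form goal) →
             ResultIs R (form start) (form goal)
    result start goal goal-rank path rank-zero-form =
      rank start , (path , rank-zero-normal goal goal-rank) , bounded , ends-in-goal
      where
      bounded : ∀ m C → SimpPath R m (form start) C → m ≤ rank start
      bounded m C (p , _) with reachable start p
      ... | s' , _ , r = subst (m ≤_) (sym r) (m≤m+n m (rank s'))

      ends-in-goal : ∀ C → SimpPath R (rank start) (form start) C → C ≡ form goal
      ends-in-goal C (p , _) with reachable start p
      ... | s' , refl , r = rank-zero-form s' rank-used-up
        where
        rank-used-up : rank s' ≡ 0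
        rank-used-up = +-cancelˡ-≡ (rank start) (rank s') 0 (trans (sym r) (sym (+-identityʳ _)))

  data Atomic : Formula At → Set where
    atom : ∀ P → Atomic (atom P)
    bot  : Atomic ⊥'
    top  : Atomic ⊤'

  -- Syntactic double negations; every left-hand side of r₃ and r₄ requires
  -- its immediate subformulas to have this shape.
  data IsDN : Formula At → Set where
    dn : ∀ W → IsDN (~~ W)

  DN-target-⊥ : ∀ {U V : Formula At} → IsDN (U ⇒ V) → V ≡ ⊥'
  DN-target-⊥ (dn _) = refl

unmarked : Bool → ℕ
unmarked false = 1
unmarked true  = 0

suc-right : ∀ u m n → u + (m + suc n) ≡ suc (u + (m + n))
suc-right u m n = trans (cong (u +_) (+-suc m n)) (+-suc u (m + n))

module Simplification₃ {At : Set} where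

  data Marking₃ : Formula At → Set where
    atomic : ∀ {Q} → Atomic Q → Marking₃ Q
    cj : ∀ {A B} → Bool → Marking₃ A → Marking₃ B → Marking₃ (A ∧' B)
    dj : ∀ {A B} → Bool → Marking₃ A → Marking₃ B → Marking₃ (A ∨' B)
    im : ∀ {A B} → Bool → Marking₃ A → Marking₃ B → Marking₃ (A ⇒ B)
    al : ∀ {x A} → Bool → Marking₃ A → Marking₃ (∀' x A)
    ex : ∀ {x A} → Marking₃ A → Marking₃ (∃' x A)

  -- An unset flag keeps the Kolmogorov shape ¬¬(…); a set flag gives the
  -- right-hand side of the corresponding r₃ rule, i.e. the clause of G.
  form₃ : ∀ {A} → Marking₃ A → Formula At
  form₃ (atomic {Q} _) = ~~ Q
  form₃ (cj false a b) = ~~ (form₃ a ∧' form₃ b)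
  form₃ (cj true  a b) = form₃ a ∧' form₃ b
  form₃ (dj false a b) = ~~ (form₃ a ∨' form₃ b)
  form₃ (dj true  a b) = ~ (form₃ a) ⇒ form₃ b
  form₃ (im false a b) = ~~ (form₃ a ⇒ form₃ b)
  form₃ (im true  a b) = form₃ a ⇒ form₃ b
  form₃ (al {x} false a) = ~~ (∀' x (form₃ a))
  form₃ (al {x} true  a) = ∀' x (form₃ a)
  form₃ (ex {x} a) = ~~ (∃' x (form₃ a))

  rank₃ : ∀ {A} → Marking₃ A → ℕ
  rank₃ (atomic _) = 0
  rank₃ (cj f a b) = unmarked f + (rank₃ a + rank₃ b)
  rank₃ (dj f a b) = unmarked f + (rank₃ a + rank₃ b)
  rank₃ (im f a b) = unmarked f + (rank₃ a + rank₃ b)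
  rank₃ (al f a) = unmarked f + rank₃ a
  rank₃ (ex a) = rank₃ a

  data Flip₃ : ∀ {A} → Marking₃ A → Marking₃ A → Set where
    ∧-here : ∀ {A B} {a : Marking₃ A} {b : Marking₃ B} → Flip₃ (cj false a b) (cj true a b)
    ∨-here : ∀ {A B} {a : Marking₃ A} {b : Marking₃ B} → Flip₃ (dj false a b) (dj true a b)
    ⇒-here : ∀ {A B} {a : Marking₃ A} {b : Marking₃ B} → Flip₃ (im false a b) (im true a b)
    ∀-here : ∀ {x A} {a : Marking₃ A} → Flip₃ (al {x = x} false a) (al true a)
    ∧-left  : ∀ {A B f} {a a' : Marking₃ A} {b : Marking₃ B} → Flip₃ a a' → Flip₃ (cj f a b) (cj f a' b)
    ∧-right : ∀ {A B f} {a : Marking₃ A} {b b' : Marking₃ B} → Flip₃ b b' → Flip₃ (cj f a b) (cj f a b')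
    ∨-left  : ∀ {A B f} {a a' : Marking₃ A} {b : Marking₃ B} → Flip₃ a a' → Flip₃ (dj f a b) (dj f a' b)
    ∨-right : ∀ {A B f} {a : Marking₃ A} {b b' : Marking₃ B} → Flip₃ b b' → Flip₃ (dj f a b) (dj f a b')
    ⇒-left  : ∀ {A B f} {a a' : Marking₃ A} {b : Marking₃ B} → Flip₃ a a' → Flip₃ (im f a b) (im f a' b)
    ⇒-right : ∀ {A B f} {a : Marking₃ A} {b b' : Marking₃ B} → Flip₃ b b' → Flip₃ (im f a b) (im f a b')
    ∀-in : ∀ {x A f} {a a' : Marking₃ A} → Flip₃ a a' → Flip₃ (al {x = x} f a) (al f a')
    ∃-in : ∀ {x A} {a a' : Marking₃ A} → Flip₃ a a' → Flip₃ (ex {x = x} a) (ex a')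

  flip₃-rank : ∀ {A} {s s' : Marking₃ A} → Flip₃ s s' → rank₃ s ≡ suc (rank₃ s')
  flip₃-rank ∧-here = refl
  flip₃-rank ∨-here = refl
  flip₃-rank ⇒-here = refl
  flip₃-rank ∀-here = refl
  flip₃-rank (∧-left {f = f} {a' = a'} {b} φ) rewrite flip₃-rank φ = +-suc (unmarked f) (rank₃ a' + rank₃ b)
  flip₃-rank (∧-right {f = f} {a} {b' = b'} φ) rewrite flip₃-rank φ = suc-right (unmarked f) (rank₃ a) (rank₃ b')
  flip₃-rank (∨-left {f = f} {a' = a'} {b} φ) rewrite flip₃-rank φ = +-suc (unmarked f) (rank₃ a' + rank₃ b)
  flip₃-rank (∨-right {f = f} {a} {b' = b'} φ) rewrite flip₃-rank φ = suc-right (unmarked f) (rank₃ a) (rank₃ b')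
  flip₃-rank (⇒-left {f = f} {a' = a'} {b} φ) rewrite flip₃-rank φ = +-suc (unmarked f) (rank₃ a' + rank₃ b)
  flip₃-rank (⇒-right {f = f} {a} {b' = b'} φ) rewrite flip₃-rank φ = suc-right (unmarked f) (rank₃ a) (rank₃ b')
  flip₃-rank (∀-in {f = f} {a' = a'} φ) rewrite flip₃-rank φ = +-suc (unmarked f) (rank₃ a')
  flip₃-rank (∃-in φ) = flip₃-rank φ

  -- Every r₃-redex is a double negation ¬¬W, so an implication whose target
  -- is not ⊥ (first lemma), or whose antecedent's target is not ⊥ (second
  -- lemma), is not a redex.
  r₃-redex-~ : ∀ {U V C} → r₃ {At} (U ⇒ V) C → V ≡ ⊥'
  r₃-redex-~ (r₃∧ _ _) = refl
  r₃-redex-~ (r₃∨ _ _) = refl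
  r₃-redex-~ (r₃⇒ _ _) = refl
  r₃-redex-~ (r₃∀ _ _) = refl

  r₃-redex-~~ : ∀ {U V W C} → r₃ {At} ((U ⇒ V) ⇒ W) C → V ≡ ⊥'
  r₃-redex-~~ (r₃∧ _ _) = refl
  r₃-redex-~~ (r₃∨ _ _) = refl
  r₃-redex-~~ (r₃⇒ _ _) = refl
  r₃-redex-~~ (r₃∀ _ _) = refl

  form₃-not-⊥ : ∀ {A} (s : Marking₃ A) → ¬ form₃ s ≡ ⊥'
  form₃-not-⊥ (atomic _) ()
  form₃-not-⊥ (cj false _ _) ()
  form₃-not-⊥ (cj true _ _) ()
  form₃-not-⊥ (dj false _ _) ()
  form₃-not-⊥ (dj true _ _) ()
  form₃-not-⊥ (im false _ _) ()
  form₃-not-⊥ (im true _ _) ()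
  form₃-not-⊥ (al false _) ()
  form₃-not-⊥ (al true _) ()
  form₃-not-⊥ (ex _) ()

  -- The two places where a marked formula could accidentally look like a
  -- redex: as the target of an implication, and under a negation.
  ⇒form₃-inert : ∀ {A U C} (s : Marking₃ A) → ¬ r₃ {At} (U ⇒ form₃ s) C
  ⇒form₃-inert s r = form₃-not-⊥ s (r₃-redex-~ r)

  ~form₃-inert : ∀ {A C} (s : Marking₃ A) → ¬ r₃ {At} (~ (form₃ s)) C
  ~form₃-inert (atomic _) ()
  ~form₃-inert (cj false _ _) ()
  ~form₃-inert (cj true _ _) ()
  ~form₃-inert (dj false _ _) ()
  ~form₃-inert (dj true _ _) ()
  ~form₃-inert (im false _ _) ()
  ~form₃-inert (im true _ b) r = form₃-not-⊥ b (r₃-redex-~~ r)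
  ~form₃-inert (al false _) ()
  ~form₃-inert (al true _) ()
  ~form₃-inert (ex _) ()

  atomic-normal₃ : ∀ {Q C} → Atomic Q → ¬ Step {At} r₃ (~~ Q) C
  atomic-normal₃ (atom _) (root ())
  atomic-normal₃ (atom _) (⇒ˡ (root ()))
  atomic-normal₃ (atom _) (⇒ˡ (⇒ˡ (root ())))
  atomic-normal₃ (atom _) (⇒ˡ (⇒ʳ (root ())))
  atomic-normal₃ (atom _) (⇒ʳ (root ()))
  atomic-normal₃ bot (root ())
  atomic-normal₃ bot (⇒ˡ (root ()))
  atomic-normal₃ bot (⇒ˡ (⇒ˡ (root ())))
  atomic-normal₃ bot (⇒ˡ (⇒ʳ (root ())))
  atomic-normal₃ bot (⇒ʳ (root ()))
  atomic-normal₃ top (root ())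
  atomic-normal₃ top (⇒ˡ (root ()))
  atomic-normal₃ top (⇒ˡ (⇒ˡ (root ())))
  atomic-normal₃ top (⇒ˡ (⇒ʳ (root ())))
  atomic-normal₃ top (⇒ʳ (root ()))

  root₃-∧ : ∀ {X Y C} → r₃ {At} (~~ (X ∧' Y)) C → C ≡ X ∧' Y
  root₃-∧ (r₃∧ _ _) = refl

  root₃-∨ : ∀ {X Y C} → r₃ {At} (~~ (X ∨' Y)) C → C ≡ (~ X ⇒ Y)
  root₃-∨ (r₃∨ _ _) = refl

  root₃-⇒ : ∀ {X Y C} → r₃ {At} (~~ (X ⇒ Y)) C → C ≡ (X ⇒ Y)
  root₃-⇒ (r₃⇒ _ _) = refl

  root₃-∀ : ∀ {x X C} → r₃ {At} (~~ (∀' x X)) C → C ≡ ∀' x X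
  root₃-∀ (r₃∀ _ _) = refl

  FlipsOnly₃ : ∀ {A} → Marking₃ A → Set
  FlipsOnly₃ {A} s = ∀ {C} → Step r₃ (form₃ s) C → Σ (Marking₃ A) λ s' → Flip₃ s s' × C ≡ form₃ s'

  flips₃-∧ : ∀ {A B} f (a : Marking₃ A) (b : Marking₃ B) → FlipsOnly₃ a → FlipsOnly₃ b → FlipsOnly₃ (cj f a b)
  flips₃-∧ false a b _ _ (root r) rewrite root₃-∧ r = cj true a b , ∧-here , refl
  flips₃-∧ false a b _ _ (⇒ˡ (root ()))
  flips₃-∧ false a b _ _ (⇒ˡ (⇒ˡ (root ())))
  flips₃-∧ false a b ia _ (⇒ˡ (⇒ˡ (∧ˡ t))) with ia t
  ... | a' , φ , refl = cj false a' b , ∧-left φ , refl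
  flips₃-∧ false a b _ ib (⇒ˡ (⇒ˡ (∧ʳ t))) with ib t
  ... | b' , φ , refl = cj false a b' , ∧-right φ , refl
  flips₃-∧ false a b _ _ (⇒ˡ (⇒ʳ (root ())))
  flips₃-∧ false a b _ _ (⇒ʳ (root ()))
  flips₃-∧ true a b _ _ (root ())
  flips₃-∧ true a b ia _ (∧ˡ t) with ia t
  ... | a' , φ , refl = cj true a' b , ∧-left φ , refl
  flips₃-∧ true a b _ ib (∧ʳ t) with ib t
  ... | b' , φ , refl = cj true a b' , ∧-right φ , refl

  flips₃-∨ : ∀ {A B} f (a : Marking₃ A) (b : Marking₃ B) → FlipsOnly₃ a → FlipsOnly₃ b → FlipsOnly₃ (dj f a b)
  flips₃-∨ false a b _ _ (root r) rewrite root₃-∨ r = dj true a b , ∨-here , refl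
  flips₃-∨ false a b _ _ (⇒ˡ (root ()))
  flips₃-∨ false a b _ _ (⇒ˡ (⇒ˡ (root ())))
  flips₃-∨ false a b ia _ (⇒ˡ (⇒ˡ (∨ˡ t))) with ia t
  ... | a' , φ , refl = dj false a' b , ∨-left φ , refl
  flips₃-∨ false a b _ ib (⇒ˡ (⇒ˡ (∨ʳ t))) with ib t
  ... | b' , φ , refl = dj false a b' , ∨-right φ , refl
  flips₃-∨ false a b _ _ (⇒ˡ (⇒ʳ (root ())))
  flips₃-∨ false a b _ _ (⇒ʳ (root ()))
  flips₃-∨ true a b _ _ (root r) = ⊥-elim (⇒form₃-inert b r)
  flips₃-∨ true a b _ _ (⇒ˡ (root r)) = ⊥-elim (~form₃-inert a r)
  flips₃-∨ true a b ia _ (⇒ˡ (⇒ˡ t)) with ia t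
  ... | a' , φ , refl = dj true a' b , ∨-left φ , refl
  flips₃-∨ true a b _ _ (⇒ˡ (⇒ʳ (root ())))
  flips₃-∨ true a b _ ib (⇒ʳ t) with ib t
  ... | b' , φ , refl = dj true a b' , ∨-right φ , refl

  flips₃-⇒ : ∀ {A B} f (a : Marking₃ A) (b : Marking₃ B) → FlipsOnly₃ a → FlipsOnly₃ b → FlipsOnly₃ (im f a b)
  flips₃-⇒ false a b _ _ (root r) rewrite root₃-⇒ r = im true a b , ⇒-here , refl
  flips₃-⇒ false a b _ _ (⇒ˡ (root r)) = ⊥-elim (~form₃-inert (im true a b) r)
  flips₃-⇒ false a b _ _ (⇒ˡ (⇒ˡ (root r))) = ⊥-elim (⇒form₃-inert b r)
  flips₃-⇒ false a b ia _ (⇒ˡ (⇒ˡ (⇒ˡ t))) with ia t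
  ... | a' , φ , refl = im false a' b , ⇒-left φ , refl
  flips₃-⇒ false a b _ ib (⇒ˡ (⇒ˡ (⇒ʳ t))) with ib t
  ... | b' , φ , refl = im false a b' , ⇒-right φ , refl
  flips₃-⇒ false a b _ _ (⇒ˡ (⇒ʳ (root ())))
  flips₃-⇒ false a b _ _ (⇒ʳ (root ()))
  flips₃-⇒ true a b _ _ (root r) = ⊥-elim (⇒form₃-inert b r)
  flips₃-⇒ true a b ia _ (⇒ˡ t) with ia t
  ... | a' , φ , refl = im true a' b , ⇒-left φ , refl
  flips₃-⇒ true a b _ ib (⇒ʳ t) with ib t
  ... | b' , φ , refl = im true a b' , ⇒-right φ , refl

  flips₃-∀ : ∀ {x A} f (a : Marking₃ A) → FlipsOnly₃ a → FlipsOnly₃ (al {x = x} f a)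
  flips₃-∀ false a _ (root r) rewrite root₃-∀ r = al true a , ∀-here , refl
  flips₃-∀ false a _ (⇒ˡ (root ()))
  flips₃-∀ false a _ (⇒ˡ (⇒ˡ (root ())))
  flips₃-∀ false a ia (⇒ˡ (⇒ˡ (∀c t))) with ia t
  ... | a' , φ , refl = al false a' , ∀-in φ , refl
  flips₃-∀ false a _ (⇒ˡ (⇒ʳ (root ())))
  flips₃-∀ false a _ (⇒ʳ (root ()))
  flips₃-∀ true a _ (root ())
  flips₃-∀ true a ia (∀c t) with ia t
  ... | a' , φ , refl = al true a' , ∀-in φ , refl

  flips₃-∃ : ∀ {x A} (a : Marking₃ A) → FlipsOnly₃ a → FlipsOnly₃ (ex {x = x} a)
  flips₃-∃ a _ (root ())
  flips₃-∃ a _ (⇒ˡ (root ()))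
  flips₃-∃ a _ (⇒ˡ (⇒ˡ (root ())))
  flips₃-∃ a ia (⇒ˡ (⇒ˡ (∃c t))) with ia t
  ... | a' , φ , refl = ex a' , ∃-in φ , refl
  flips₃-∃ a _ (⇒ˡ (⇒ʳ (root ())))
  flips₃-∃ a _ (⇒ʳ (root ()))

  flips₃ : ∀ {A} (s : Marking₃ A) → FlipsOnly₃ s
  flips₃ (atomic q) st = ⊥-elim (atomic-normal₃ q st)
  flips₃ (cj f a b) = flips₃-∧ f a b (flips₃ a) (flips₃ b)
  flips₃ (dj f a b) = flips₃-∨ f a b (flips₃ a) (flips₃ b)
  flips₃ (im f a b) = flips₃-⇒ f a b (flips₃ a) (flips₃ b)
  flips₃ (al f a) = flips₃-∀ f a (flips₃ a)
  flips₃ (ex a) = flips₃-∃ a (flips₃ a)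

  unsimplified₃ : ∀ A → Marking₃ A
  unsimplified₃ (atom P) = atomic (atom P)
  unsimplified₃ ⊥' = atomic bot
  unsimplified₃ ⊤' = atomic top
  unsimplified₃ (A ∧' B) = cj false (unsimplified₃ A) (unsimplified₃ B)
  unsimplified₃ (A ∨' B) = dj false (unsimplified₃ A) (unsimplified₃ B)
  unsimplified₃ (A ⇒ B) = im false (unsimplified₃ A) (unsimplified₃ B)
  unsimplified₃ (∀' x A) = al false (unsimplified₃ A)
  unsimplified₃ (∃' x A) = ex (unsimplified₃ A)

  simplified₃ : ∀ A → Marking₃ A
  simplified₃ (atom P) = atomic (atom P)
  simplified₃ ⊥' = atomic bot
  simplified₃ ⊤' = atomic top
  simplified₃ (A ∧' B) = cj true (simplified₃ A) (simplified₃ B)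
  simplified₃ (A ∨' B) = dj true (simplified₃ A) (simplified₃ B)
  simplified₃ (A ⇒ B) = im true (simplified₃ A) (simplified₃ B)
  simplified₃ (∀' x A) = al true (simplified₃ A)
  simplified₃ (∃' x A) = ex (simplified₃ A)

  unsimplified₃-Ko : ∀ A → form₃ (unsimplified₃ A) ≡ Ko A
  unsimplified₃-Ko (atom P) = refl
  unsimplified₃-Ko ⊥' = refl
  unsimplified₃-Ko ⊤' = refl
  unsimplified₃-Ko (A ∧' B) = cong₂ (λ U V → ~~ (U ∧' V)) (unsimplified₃-Ko A) (unsimplified₃-Ko B)
  unsimplified₃-Ko (A ∨' B) = cong₂ (λ U V → ~~ (U ∨' V)) (unsimplified₃-Ko A) (unsimplified₃-Ko B)
  unsimplified₃-Ko (A ⇒ B) = cong₂ (λ U V → ~~ (U ⇒ V)) (unsimplified₃-Ko A) (unsimplified₃-Ko B)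
  unsimplified₃-Ko (∀' x A) = cong (λ U → ~~ (∀' x U)) (unsimplified₃-Ko A)
  unsimplified₃-Ko (∃' x A) = cong (λ U → ~~ (∃' x U)) (unsimplified₃-Ko A)

  simplified₃-G : ∀ A → form₃ (simplified₃ A) ≡ G A
  simplified₃-G (atom P) = refl
  simplified₃-G ⊥' = refl
  simplified₃-G ⊤' = refl
  simplified₃-G (A ∧' B) = cong₂ _∧'_ (simplified₃-G A) (simplified₃-G B)
  simplified₃-G (A ∨' B) = cong₂ (λ U V → ~ U ⇒ V) (simplified₃-G A) (simplified₃-G B)
  simplified₃-G (A ⇒ B) = cong₂ _⇒_ (simplified₃-G A) (simplified₃-G B)
  simplified₃-G (∀' x A) = cong (∀' x) (simplified₃-G A)
  simplified₃-G (∃' x A) = cong (λ U → ~~ (∃' x U)) (simplified₃-G A)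

  simplified₃-rank : ∀ A → rank₃ (simplified₃ A) ≡ 0
  simplified₃-rank (atom P) = refl
  simplified₃-rank ⊥' = refl
  simplified₃-rank ⊤' = refl
  simplified₃-rank (A ∧' B) = cong₂ _+_ (simplified₃-rank A) (simplified₃-rank B)
  simplified₃-rank (A ∨' B) = cong₂ _+_ (simplified₃-rank A) (simplified₃-rank B)
  simplified₃-rank (A ⇒ B) = cong₂ _+_ (simplified₃-rank A) (simplified₃-rank B)
  simplified₃-rank (∀' x A) = simplified₃-rank A
  simplified₃-rank (∃' x A) = simplified₃-rank A

  rank₃-zero : ∀ {A} (s : Marking₃ A) → rank₃ s ≡ 0 → form₃ s ≡ form₃ (simplified₃ A)
  rank₃-zero (atomic (atom _)) _ = refl
  rank₃-zero (atomic bot) _ = refl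
  rank₃-zero (atomic top) _ = refl
  rank₃-zero (cj true a b) r = cong₂ _∧'_ (rank₃-zero a (m+n≡0⇒m≡0 _ r)) (rank₃-zero b (m+n≡0⇒n≡0 (rank₃ a) r))
  rank₃-zero (dj true a b) r = cong₂ (λ U V → ~ U ⇒ V) (rank₃-zero a (m+n≡0⇒m≡0 _ r)) (rank₃-zero b (m+n≡0⇒n≡0 (rank₃ a) r))
  rank₃-zero (im true a b) r = cong₂ _⇒_ (rank₃-zero a (m+n≡0⇒m≡0 _ r)) (rank₃-zero b (m+n≡0⇒n≡0 (rank₃ a) r))
  rank₃-zero (al {x} true a) r = cong (∀' x) (rank₃-zero a r)
  rank₃-zero (ex {x} a) r = cong (λ U → ~~ (∃' x U)) (rank₃-zero a r)

  unsimplified₃-DN : ∀ A → IsDN (form₃ (unsimplified₃ A))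
  unsimplified₃-DN (atom P) = dn _
  unsimplified₃-DN ⊥' = dn _
  unsimplified₃-DN ⊤' = dn _
  unsimplified₃-DN (A ∧' B) = dn _
  unsimplified₃-DN (A ∨' B) = dn _
  unsimplified₃-DN (A ⇒ B) = dn _
  unsimplified₃-DN (∀' x A) = dn _
  unsimplified₃-DN (∃' x A) = dn _

  fire₃-∧ : ∀ {X Y} → IsDN X → IsDN Y → Step {At} r₃ (~~ (X ∧' Y)) (X ∧' Y)
  fire₃-∧ (dn A) (dn B) = root (r₃∧ A B)

  fire₃-∨ : ∀ {X Y} → IsDN X → IsDN Y → Step {At} r₃ (~~ (X ∨' Y)) (~ X ⇒ Y)
  fire₃-∨ (dn A) (dn B) = root (r₃∨ A B)

  fire₃-⇒ : ∀ {X Y} → IsDN X → IsDN Y → Step {At} r₃ (~~ (X ⇒ Y)) (X ⇒ Y)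
  fire₃-⇒ (dn A) (dn B) = root (r₃⇒ A B)

  fire₃-∀ : ∀ {x X} → IsDN X → Step {At} r₃ (~~ (∀' x X)) (∀' x X)
  fire₃-∀ (dn A) = root (r₃∀ _ A)

  simplify₃ : ∀ A → Steps {At} r₃ (rank₃ (unsimplified₃ A)) (form₃ (unsimplified₃ A)) (form₃ (simplified₃ A))
  simplify₃ (atom P) = done
  simplify₃ ⊥' = done
  simplify₃ ⊤' = done
  simplify₃ (A ∧' B) =
    fire₃-∧ (unsimplified₃-DN A) (unsimplified₃-DN B)
    ∷ (inContext (_∧' form₃ (unsimplified₃ B)) ∧ˡ (simplify₃ A)
       ++ˢ inContext (form₃ (simplified₃ A) ∧'_) ∧ʳ (simplify₃ B))
  simplify₃ (A ∨' B) =
    fire₃-∨ (unsimplified₃-DN A) (unsimplified₃-DN B)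
    ∷ (inContext (λ U → ~ U ⇒ form₃ (unsimplified₃ B)) (λ t → ⇒ˡ (⇒ˡ t)) (simplify₃ A)
       ++ˢ inContext (~ (form₃ (simplified₃ A)) ⇒_) ⇒ʳ (simplify₃ B))
  simplify₃ (A ⇒ B) =
    fire₃-⇒ (unsimplified₃-DN A) (unsimplified₃-DN B)
    ∷ (inContext (_⇒ form₃ (unsimplified₃ B)) ⇒ˡ (simplify₃ A)
       ++ˢ inContext (form₃ (simplified₃ A) ⇒_) ⇒ʳ (simplify₃ B))
  simplify₃ (∀' x A) = fire₃-∀ (unsimplified₃-DN A) ∷ inContext (∀' x) ∀c (simplify₃ A)
  simplify₃ (∃' x A) = inContext (λ U → ~~ (∃' x U)) (λ t → ⇒ˡ (⇒ˡ (∃c t))) (simplify₃ A)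

  result₃ : ∀ A → ResultIs r₃ (Ko A) (G A)
  result₃ A = subst₂ (ResultIs r₃) (unsimplified₃-Ko A) (simplified₃-G A)
    (result (unsimplified₃ A) (simplified₃ A) (simplified₃-rank A) (simplify₃ A) rank₃-zero)
    where open RankArgument r₃ form₃ rank₃ Flip₃ flip₃-rank flips₃

module Simplification₄ {At : Set} where

  -- All r₄ rules rewrite a negation ¬N, so a marking describes
  -- the formula N (neg₄); its reachable formula is form₄ = ¬N.
  data Marking₄ : Formula At → Set where
    atomic : ∀ {Q} → Atomic Q → Marking₄ Q
    cj : ∀ {A B} → Bool → Marking₄ A → Marking₄ B → Marking₄ (A ∧' B)
    dj : ∀ {A B} → Bool → Marking₄ A → Marking₄ B → Marking₄ (A ∨' B)
    im : ∀ {A B} → Bool → Marking₄ A → Marking₄ B → Marking₄ (A ⇒ B)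
    al : ∀ {x A} → Marking₄ A → Marking₄ (∀' x A)
    ex : ∀ {x A} → Bool → Marking₄ A → Marking₄ (∃' x A)

  -- With an unset flag, ¬N has the Kolmogorov shape ¬¬(…); a set flag gives
  -- the clause of A_E.
  neg₄ : ∀ {A} → Marking₄ A → Formula At
  form₄ : ∀ {A} → Marking₄ A → Formula At
  form₄ s = ~ (neg₄ s)
  neg₄ (atomic {Q} _) = ~ Q
  neg₄ (cj false a b) = ~ (form₄ a ∧' form₄ b)
  neg₄ (cj true  a b) = form₄ a ⇒ neg₄ b
  neg₄ (dj false a b) = ~ (form₄ a ∨' form₄ b)
  neg₄ (dj true  a b) = neg₄ a ∧' neg₄ b
  neg₄ (im false a b) = ~ (form₄ a ⇒ form₄ b)
  neg₄ (im true  a b) = form₄ a ∧' neg₄ b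
  neg₄ (al {x} a) = ~ (∀' x (form₄ a))
  neg₄ (ex {x} false a) = ~ (∃' x (form₄ a))
  neg₄ (ex {x} true  a) = ∀' x (neg₄ a)

  rank₄ : ∀ {A} → Marking₄ A → ℕ
  rank₄ (atomic _) = 0
  rank₄ (cj f a b) = unmarked f + (rank₄ a + rank₄ b)
  rank₄ (dj f a b) = unmarked f + (rank₄ a + rank₄ b)
  rank₄ (im f a b) = unmarked f + (rank₄ a + rank₄ b)
  rank₄ (al a) = rank₄ a
  rank₄ (ex f a) = unmarked f + rank₄ a

  data Flip₄ : ∀ {A} → Marking₄ A → Marking₄ A → Set where
    ∧-here : ∀ {A B} {a : Marking₄ A} {b : Marking₄ B} → Flip₄ (cj false a b) (cj true a b)
    ∨-here : ∀ {A B} {a : Marking₄ A} {b : Marking₄ B} → Flip₄ (dj false a b) (dj true a b)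
    ⇒-here : ∀ {A B} {a : Marking₄ A} {b : Marking₄ B} → Flip₄ (im false a b) (im true a b)
    ∃-here : ∀ {x A} {a : Marking₄ A} → Flip₄ (ex {x = x} false a) (ex true a)
    ∧-left  : ∀ {A B f} {a a' : Marking₄ A} {b : Marking₄ B} → Flip₄ a a' → Flip₄ (cj f a b) (cj f a' b)
    ∧-right : ∀ {A B f} {a : Marking₄ A} {b b' : Marking₄ B} → Flip₄ b b' → Flip₄ (cj f a b) (cj f a b')
    ∨-left  : ∀ {A B f} {a a' : Marking₄ A} {b : Marking₄ B} → Flip₄ a a' → Flip₄ (dj f a b) (dj f a' b)
    ∨-right : ∀ {A B f} {a : Marking₄ A} {b b' : Marking₄ B} → Flip₄ b b' → Flip₄ (dj f a b) (dj f a b')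
    ⇒-left  : ∀ {A B f} {a a' : Marking₄ A} {b : Marking₄ B} → Flip₄ a a' → Flip₄ (im f a b) (im f a' b)
    ⇒-right : ∀ {A B f} {a : Marking₄ A} {b b' : Marking₄ B} → Flip₄ b b' → Flip₄ (im f a b) (im f a b')
    ∀-in : ∀ {x A} {a a' : Marking₄ A} → Flip₄ a a' → Flip₄ (al {x = x} a) (al a')
    ∃-in : ∀ {x A f} {a a' : Marking₄ A} → Flip₄ a a' → Flip₄ (ex {x = x} f a) (ex f a')

  flip₄-rank : ∀ {A} {s s' : Marking₄ A} → Flip₄ s s' → rank₄ s ≡ suc (rank₄ s')
  flip₄-rank ∧-here = refl
  flip₄-rank ∨-here = refl
  flip₄-rank ⇒-here = refl
  flip₄-rank ∃-here = refl
  flip₄-rank (∧-left {f = f} {a' = a'} {b} φ) rewrite flip₄-rank φ = +-suc (unmarked f) (rank₄ a' + rank₄ b)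
  flip₄-rank (∧-right {f = f} {a} {b' = b'} φ) rewrite flip₄-rank φ = suc-right (unmarked f) (rank₄ a) (rank₄ b')
  flip₄-rank (∨-left {f = f} {a' = a'} {b} φ) rewrite flip₄-rank φ = +-suc (unmarked f) (rank₄ a' + rank₄ b)
  flip₄-rank (∨-right {f = f} {a} {b' = b'} φ) rewrite flip₄-rank φ = suc-right (unmarked f) (rank₄ a) (rank₄ b')
  flip₄-rank (⇒-left {f = f} {a' = a'} {b} φ) rewrite flip₄-rank φ = +-suc (unmarked f) (rank₄ a' + rank₄ b)
  flip₄-rank (⇒-right {f = f} {a} {b' = b'} φ) rewrite flip₄-rank φ = suc-right (unmarked f) (rank₄ a) (rank₄ b')
  flip₄-rank (∀-in φ) = flip₄-rank φ
  flip₄-rank (∃-in {f = f} {a' = a'} φ) rewrite flip₄-rank φ = +-suc (unmarked f) (rank₄ a')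

  r₄-redex-~ : ∀ {U V C} → r₄ {At} (U ⇒ V) C → V ≡ ⊥'
  r₄-redex-~ (r₄∧ _ _) = refl
  r₄-redex-~ (r₄∨ _ _) = refl
  r₄-redex-~ (r₄⇒ _ _) = refl
  r₄-redex-~ (r₄∃ _ _) = refl

  r₄-redex-∧ : ∀ {U V C} → r₄ {At} (~ (U ∧' V)) C → IsDN U × IsDN V
  r₄-redex-∧ (r₄∧ A B) = dn A , dn B

  r₄-redex-⇒ : ∀ {U V C} → r₄ {At} (~ (U ⇒ V)) C → IsDN V
  r₄-redex-⇒ (r₄⇒ _ B) = dn B

  -- The N-part of a marking is never ⊥ and never a double negation, so it is
  -- never the argument of an r₄-pattern, and ¬N is never a redex (form₄-inert).
  neg₄-not-⊥ : ∀ {A} (s : Marking₄ A) → ¬ neg₄ s ≡ ⊥'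
  neg₄-not-⊥ (atomic _) ()
  neg₄-not-⊥ (cj false _ _) ()
  neg₄-not-⊥ (cj true _ _) ()
  neg₄-not-⊥ (dj false _ _) ()
  neg₄-not-⊥ (dj true _ _) ()
  neg₄-not-⊥ (im false _ _) ()
  neg₄-not-⊥ (im true _ _) ()
  neg₄-not-⊥ (al _) ()
  neg₄-not-⊥ (ex false _) ()
  neg₄-not-⊥ (ex true _) ()

  neg₄-not-DN : ∀ {A} (s : Marking₄ A) → ¬ IsDN (neg₄ s)
  neg₄-not-DN (atomic (atom _)) ()
  neg₄-not-DN (atomic bot) ()
  neg₄-not-DN (atomic top) ()
  neg₄-not-DN (cj false _ _) ()
  neg₄-not-DN (cj true _ b) d = neg₄-not-⊥ b (DN-target-⊥ d)
  neg₄-not-DN (dj false _ _) ()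
  neg₄-not-DN (dj true _ _) ()
  neg₄-not-DN (im false _ _) ()
  neg₄-not-DN (im true _ _) ()
  neg₄-not-DN (al _) ()
  neg₄-not-DN (ex false _) ()
  neg₄-not-DN (ex true _) ()

  form₄-inert : ∀ {A C} (s : Marking₄ A) → ¬ r₄ {At} (form₄ s) C
  form₄-inert (atomic _) ()
  form₄-inert (cj false _ _) ()
  form₄-inert (cj true _ b) r = neg₄-not-DN b (r₄-redex-⇒ r)
  form₄-inert (dj false _ _) ()
  form₄-inert (dj true a _) r = neg₄-not-DN a (proj₁ (r₄-redex-∧ r))
  form₄-inert (im false _ _) ()
  form₄-inert (im true _ b) r = neg₄-not-DN b (proj₂ (r₄-redex-∧ r))
  form₄-inert (al _) ()
  form₄-inert (ex false _) ()
  form₄-inert (ex true _) ()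

  atomic-normal₄ : ∀ {Q C} → Atomic Q → ¬ Step {At} r₄ (~ Q) C
  atomic-normal₄ (atom _) (root ())
  atomic-normal₄ (atom _) (⇒ˡ (root ()))
  atomic-normal₄ (atom _) (⇒ʳ (root ()))
  atomic-normal₄ bot (root ())
  atomic-normal₄ bot (⇒ˡ (root ()))
  atomic-normal₄ bot (⇒ʳ (root ()))
  atomic-normal₄ top (root ())
  atomic-normal₄ top (⇒ˡ (root ()))
  atomic-normal₄ top (⇒ʳ (root ()))

  root₄-∧ : ∀ {X Y C} → r₄ {At} (~ (X ∧' ~ Y)) C → C ≡ (X ⇒ Y)
  root₄-∧ (r₄∧ _ _) = refl

  root₄-∨ : ∀ {X Y C} → r₄ {At} (~ (~ X ∨' ~ Y)) C → C ≡ X ∧' Y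
  root₄-∨ (r₄∨ _ _) = refl

  root₄-⇒ : ∀ {X Y C} → r₄ {At} (~ (X ⇒ ~ Y)) C → C ≡ X ∧' Y
  root₄-⇒ (r₄⇒ _ _) = refl

  root₄-∃ : ∀ {x X C} → r₄ {At} (~ (∃' x (~ X))) C → C ≡ ∀' x X
  root₄-∃ (r₄∃ _ _) = refl

  FlipsOnly₄ : ∀ {A} → Marking₄ A → Set
  FlipsOnly₄ {A} s = ∀ {C} → Step r₄ (neg₄ s) C → Σ (Marking₄ A) λ s' → Flip₄ s s' × C ≡ neg₄ s'

  FlipsOnly₄-form : ∀ {A} → Marking₄ A → Set
  FlipsOnly₄-form {A} s = ∀ {C} → Step r₄ (form₄ s) C → Σ (Marking₄ A) λ s' → Flip₄ s s' × C ≡ form₄ s'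

  -- A step in ¬N is a step in N, since ¬N itself is not a redex.
  flips₄-form : ∀ {A} (s : Marking₄ A) → FlipsOnly₄ s → FlipsOnly₄-form s
  flips₄-form s _ (root r) = ⊥-elim (form₄-inert s r)
  flips₄-form s is (⇒ˡ t) with is t
  ... | s' , φ , refl = s' , φ , refl
  flips₄-form s _ (⇒ʳ (root ()))

  flips₄-∧ : ∀ {A B} f (a : Marking₄ A) (b : Marking₄ B) → FlipsOnly₄ a → FlipsOnly₄ b → FlipsOnly₄ (cj f a b)
  flips₄-∧ false a b _ _ (root r) rewrite root₄-∧ r = cj true a b , ∧-here , refl
  flips₄-∧ false a b _ _ (⇒ˡ (root ()))
  flips₄-∧ false a b ia _ (⇒ˡ (∧ˡ t)) with flips₄-form a ia t
  ... | a' , φ , refl = cj false a' b , ∧-left φ , refl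
  flips₄-∧ false a b _ ib (⇒ˡ (∧ʳ t)) with flips₄-form b ib t
  ... | b' , φ , refl = cj false a b' , ∧-right φ , refl
  flips₄-∧ false a b _ _ (⇒ʳ (root ()))
  flips₄-∧ true a b _ _ (root r) = ⊥-elim (neg₄-not-⊥ b (r₄-redex-~ r))
  flips₄-∧ true a b ia _ (⇒ˡ t) with flips₄-form a ia t
  ... | a' , φ , refl = cj true a' b , ∧-left φ , refl
  flips₄-∧ true a b _ ib (⇒ʳ t) with ib t
  ... | b' , φ , refl = cj true a b' , ∧-right φ , refl

  flips₄-∨ : ∀ {A B} f (a : Marking₄ A) (b : Marking₄ B) → FlipsOnly₄ a → FlipsOnly₄ b → FlipsOnly₄ (dj f a b)
  flips₄-∨ false a b _ _ (root r) rewrite root₄-∨ r = dj true a b , ∨-here , refl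
  flips₄-∨ false a b _ _ (⇒ˡ (root ()))
  flips₄-∨ false a b ia _ (⇒ˡ (∨ˡ t)) with flips₄-form a ia t
  ... | a' , φ , refl = dj false a' b , ∨-left φ , refl
  flips₄-∨ false a b _ ib (⇒ˡ (∨ʳ t)) with flips₄-form b ib t
  ... | b' , φ , refl = dj false a b' , ∨-right φ , refl
  flips₄-∨ false a b _ _ (⇒ʳ (root ()))
  flips₄-∨ true a b _ _ (root ())
  flips₄-∨ true a b ia _ (∧ˡ t) with ia t
  ... | a' , φ , refl = dj true a' b , ∨-left φ , refl
  flips₄-∨ true a b _ ib (∧ʳ t) with ib t
  ... | b' , φ , refl = dj true a b' , ∨-right φ , refl

  flips₄-⇒ : ∀ {A B} f (a : Marking₄ A) (b : Marking₄ B) → FlipsOnly₄ a → FlipsOnly₄ b → FlipsOnly₄ (im f a b)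
  flips₄-⇒ false a b _ _ (root r) rewrite root₄-⇒ r = im true a b , ⇒-here , refl
  flips₄-⇒ false a b _ _ (⇒ˡ (root ()))
  flips₄-⇒ false a b ia _ (⇒ˡ (⇒ˡ t)) with flips₄-form a ia t
  ... | a' , φ , refl = im false a' b , ⇒-left φ , refl
  flips₄-⇒ false a b _ ib (⇒ˡ (⇒ʳ t)) with flips₄-form b ib t
  ... | b' , φ , refl = im false a b' , ⇒-right φ , refl
  flips₄-⇒ false a b _ _ (⇒ʳ (root ()))
  flips₄-⇒ true a b _ _ (root ())
  flips₄-⇒ true a b ia _ (∧ˡ t) with flips₄-form a ia t
  ... | a' , φ , refl = im true a' b , ⇒-left φ , refl
  flips₄-⇒ true a b _ ib (∧ʳ t) with ib t
  ... | b' , φ , refl = im true a b' , ⇒-right φ , refl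

  flips₄-∀ : ∀ {x A} (a : Marking₄ A) → FlipsOnly₄ a → FlipsOnly₄ (al {x = x} a)
  flips₄-∀ a _ (root ())
  flips₄-∀ a _ (⇒ˡ (root ()))
  flips₄-∀ a ia (⇒ˡ (∀c t)) with flips₄-form a ia t
  ... | a' , φ , refl = al a' , ∀-in φ , refl
  flips₄-∀ a _ (⇒ʳ (root ()))

  flips₄-∃ : ∀ {x A} f (a : Marking₄ A) → FlipsOnly₄ a → FlipsOnly₄ (ex {x = x} f a)
  flips₄-∃ false a _ (root r) rewrite root₄-∃ r = ex true a , ∃-here , refl
  flips₄-∃ false a _ (⇒ˡ (root ()))
  flips₄-∃ false a ia (⇒ˡ (∃c t)) with flips₄-form a ia t
  ... | a' , φ , refl = ex false a' , ∃-in φ , refl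
  flips₄-∃ false a _ (⇒ʳ (root ()))
  flips₄-∃ true a _ (root ())
  flips₄-∃ true a ia (∀c t) with ia t
  ... | a' , φ , refl = ex true a' , ∃-in φ , refl

  flips₄ : ∀ {A} (s : Marking₄ A) → FlipsOnly₄ s
  flips₄ (atomic q) st = ⊥-elim (atomic-normal₄ q st)
  flips₄ (cj f a b) = flips₄-∧ f a b (flips₄ a) (flips₄ b)
  flips₄ (dj f a b) = flips₄-∨ f a b (flips₄ a) (flips₄ b)
  flips₄ (im f a b) = flips₄-⇒ f a b (flips₄ a) (flips₄ b)
  flips₄ (al a) = flips₄-∀ a (flips₄ a)
  flips₄ (ex f a) = flips₄-∃ f a (flips₄ a)

  unsimplified₄ : ∀ A → Marking₄ A
  unsimplified₄ (atom P) = atomic (atom P)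
  unsimplified₄ ⊥' = atomic bot
  unsimplified₄ ⊤' = atomic top
  unsimplified₄ (A ∧' B) = cj false (unsimplified₄ A) (unsimplified₄ B)
  unsimplified₄ (A ∨' B) = dj false (unsimplified₄ A) (unsimplified₄ B)
  unsimplified₄ (A ⇒ B) = im false (unsimplified₄ A) (unsimplified₄ B)
  unsimplified₄ (∀' x A) = al (unsimplified₄ A)
  unsimplified₄ (∃' x A) = ex false (unsimplified₄ A)

  simplified₄ : ∀ A → Marking₄ A
  simplified₄ (atom P) = atomic (atom P)
  simplified₄ ⊥' = atomic bot
  simplified₄ ⊤' = atomic top
  simplified₄ (A ∧' B) = cj true (simplified₄ A) (simplified₄ B)
  simplified₄ (A ∨' B) = dj true (simplified₄ A) (simplified₄ B)
  simplified₄ (A ⇒ B) = im true (simplified₄ A) (simplified₄ B)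
  simplified₄ (∀' x A) = al (simplified₄ A)
  simplified₄ (∃' x A) = ex true (simplified₄ A)

  unsimplified₄-Ko : ∀ A → form₄ (unsimplified₄ A) ≡ Ko A
  unsimplified₄-Ko (atom P) = refl
  unsimplified₄-Ko ⊥' = refl
  unsimplified₄-Ko ⊤' = refl
  unsimplified₄-Ko (A ∧' B) = cong₂ (λ U V → ~~ (U ∧' V)) (unsimplified₄-Ko A) (unsimplified₄-Ko B)
  unsimplified₄-Ko (A ∨' B) = cong₂ (λ U V → ~~ (U ∨' V)) (unsimplified₄-Ko A) (unsimplified₄-Ko B)
  unsimplified₄-Ko (A ⇒ B) = cong₂ (λ U V → ~~ (U ⇒ V)) (unsimplified₄-Ko A) (unsimplified₄-Ko B)
  unsimplified₄-Ko (∀' x A) = cong (λ U → ~~ (∀' x U)) (unsimplified₄-Ko A)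
  unsimplified₄-Ko (∃' x A) = cong (λ U → ~~ (∃' x U)) (unsimplified₄-Ko A)

  simplified₄-E : ∀ A → neg₄ (simplified₄ A) ≡ E↓ A
  simplified₄-E (atom P) = refl
  simplified₄-E ⊥' = refl
  simplified₄-E ⊤' = refl
  simplified₄-E (A ∧' B) = cong₂ (λ U V → ~ U ⇒ V) (simplified₄-E A) (simplified₄-E B)
  simplified₄-E (A ∨' B) = cong₂ _∧'_ (simplified₄-E A) (simplified₄-E B)
  simplified₄-E (A ⇒ B) = cong₂ (λ U V → ~ U ∧' V) (simplified₄-E A) (simplified₄-E B)
  simplified₄-E (∀' x A) = cong (λ U → ~ (∀' x (~ U))) (simplified₄-E A)
  simplified₄-E (∃' x A) = cong (∀' x) (simplified₄-E A)

  simplified₄-rank : ∀ A → rank₄ (simplified₄ A) ≡ 0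
  simplified₄-rank (atom P) = refl
  simplified₄-rank ⊥' = refl
  simplified₄-rank ⊤' = refl
  simplified₄-rank (A ∧' B) = cong₂ _+_ (simplified₄-rank A) (simplified₄-rank B)
  simplified₄-rank (A ∨' B) = cong₂ _+_ (simplified₄-rank A) (simplified₄-rank B)
  simplified₄-rank (A ⇒ B) = cong₂ _+_ (simplified₄-rank A) (simplified₄-rank B)
  simplified₄-rank (∀' x A) = simplified₄-rank A
  simplified₄-rank (∃' x A) = simplified₄-rank A

  rank₄-zero : ∀ {A} (s : Marking₄ A) → rank₄ s ≡ 0 → neg₄ s ≡ neg₄ (simplified₄ A)
  rank₄-zero (atomic (atom _)) _ = refl
  rank₄-zero (atomic bot) _ = refl
  rank₄-zero (atomic top) _ = refl
  rank₄-zero (cj true a b) r = cong₂ (λ U V → ~ U ⇒ V) (rank₄-zero a (m+n≡0⇒m≡0 _ r)) (rank₄-zero b (m+n≡0⇒n≡0 (rank₄ a) r))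
  rank₄-zero (dj true a b) r = cong₂ _∧'_ (rank₄-zero a (m+n≡0⇒m≡0 _ r)) (rank₄-zero b (m+n≡0⇒n≡0 (rank₄ a) r))
  rank₄-zero (im true a b) r = cong₂ (λ U V → ~ U ∧' V) (rank₄-zero a (m+n≡0⇒m≡0 _ r)) (rank₄-zero b (m+n≡0⇒n≡0 (rank₄ a) r))
  rank₄-zero (al {x} a) r = cong (λ U → ~ (∀' x (~ U))) (rank₄-zero a r)
  rank₄-zero (ex {x} true a) r = cong (∀' x) (rank₄-zero a r)

  unsimplified₄-DN : ∀ A → IsDN (form₄ (unsimplified₄ A))
  unsimplified₄-DN (atom P) = dn _
  unsimplified₄-DN ⊥' = dn _
  unsimplified₄-DN ⊤' = dn _
  unsimplified₄-DN (A ∧' B) = dn _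
  unsimplified₄-DN (A ∨' B) = dn _
  unsimplified₄-DN (A ⇒ B) = dn _
  unsimplified₄-DN (∀' x A) = dn _
  unsimplified₄-DN (∃' x A) = dn _

  fire₄-∧ : ∀ {X Y} → IsDN X → IsDN (~ Y) → Step {At} r₄ (~ (X ∧' ~ Y)) (X ⇒ Y)
  fire₄-∧ (dn A) (dn B) = root (r₄∧ A B)

  fire₄-∨ : ∀ {X Y} → IsDN (~ X) → IsDN (~ Y) → Step {At} r₄ (~ (~ X ∨' ~ Y)) (X ∧' Y)
  fire₄-∨ (dn A) (dn B) = root (r₄∨ A B)

  fire₄-⇒ : ∀ {X Y} → IsDN X → IsDN (~ Y) → Step {At} r₄ (~ (X ⇒ ~ Y)) (X ∧' Y)
  fire₄-⇒ (dn A) (dn B) = root (r₄⇒ A B)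

  fire₄-∃ : ∀ {x X} → IsDN (~ X) → Step {At} r₄ (~ (∃' x (~ X))) (∀' x X)
  fire₄-∃ (dn A) = root (r₄∃ _ A)

  simplify₄ : ∀ A → Steps {At} r₄ (rank₄ (unsimplified₄ A)) (neg₄ (unsimplified₄ A)) (neg₄ (simplified₄ A))
  simplify₄ (atom P) = done
  simplify₄ ⊥' = done
  simplify₄ ⊤' = done
  simplify₄ (A ∧' B) =
    fire₄-∧ (unsimplified₄-DN A) (unsimplified₄-DN B)
    ∷ (inContext (λ U → ~ U ⇒ neg₄ (unsimplified₄ B)) (λ t → ⇒ˡ (⇒ˡ t)) (simplify₄ A)
       ++ˢ inContext (form₄ (simplified₄ A) ⇒_) ⇒ʳ (simplify₄ B))
  simplify₄ (A ∨' B) =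
    fire₄-∨ (unsimplified₄-DN A) (unsimplified₄-DN B)
    ∷ (inContext (_∧' neg₄ (unsimplified₄ B)) ∧ˡ (simplify₄ A)
       ++ˢ inContext (neg₄ (simplified₄ A) ∧'_) ∧ʳ (simplify₄ B))
  simplify₄ (A ⇒ B) =
    fire₄-⇒ (unsimplified₄-DN A) (unsimplified₄-DN B)
    ∷ (inContext (λ U → ~ U ∧' neg₄ (unsimplified₄ B)) (λ t → ∧ˡ (⇒ˡ t)) (simplify₄ A)
       ++ˢ inContext (form₄ (simplified₄ A) ∧'_) ∧ʳ (simplify₄ B))
  simplify₄ (∀' x A) = inContext (λ U → ~ (∀' x (~ U))) (λ t → ⇒ˡ (∀c (⇒ˡ t))) (simplify₄ A)
  simplify₄ (∃' x A) = fire₄-∃ (unsimplified₄-DN A) ∷ inContext (∀' x) ∀c (simplify₄ A)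

  result₄ : ∀ A → ResultIs r₄ (Ko A) (E↑ A)
  result₄ A = subst₂ (ResultIs r₄) (unsimplified₄-Ko A) (cong ~ (simplified₄-E A))
    (result (unsimplified₄ A) (simplified₄ A) (simplified₄-rank A)
            (inContext ~ ⇒ˡ (simplify₄ A)) (λ s r → cong ~ (rank₄-zero s r)))
    where open RankArgument r₄ form₄ rank₄ Flip₄ flip₄-rank (λ s → flips₄-form s (flips₄ s))

open Simplification₃ using (result₃)
open Simplification₄ using (result₄)

proposition18 : {At : Set} (A : Formula At) →
    ResultIs r₃ (Ko A) (G A) × ResultIs r₄ (Ko A) (E↑ A)
proposition18 A = result₃ A , result₄ A
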